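{- For all integers $m\ge 0$ and $k\ge 1$, \[ \sum_{j=0}^{\min(m,\,k-m-1)}C^{(k-2j)}_{j}=\binom{k-1}{m}. \]
   Context: For integers $k\ge 0$ and $n$, $C^{(k)}_n=[x^n]C(x)^k$ where $C(x)=\sum_{n\ge0}\frac{1}{n+1}\binom{2n}{n}x^n$; equivalently $C^{(k)}_n=\binom{2n+k-1}{n}-\binom{2n+k-1}{n-1}=\frac{k}{2n+k}\binom{2n+k}{n}$ for $n\ge0,k\ge1$, and $C^{(0)}_n=\delta_{n,0}$. An empty sum is $0$. -}

module Defs where

open import Data.Nat using (ℕ; zero; suc; _+_; _*_; _∸_; _⊓_; _<ᵇ_)
open import Data.Nat.Combinatorics using (_C_)
open import Data.Integer using (ℤ; +_; _-_) renaming (_+_ to _+ℤ_)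
open import Data.Bool using (if_then_else_)

-- Generalized Catalan numbers C^{(k)}_n = [x^n] C(x)^k, via the closed form
--   C^{(0)}_n = δ_{n,0},
--   C^{(k)}_n = binom(2n+k-1, n) - binom(2n+k-1, n-1)   (k ≥ 1),
-- with binom(_, -1) = 0.  Valued in ℤ so the subtraction is genuine.
genCat : ℕ → ℕ → ℤ
genCat zero    zero    = + 1
genCat zero    (suc n) = + 0
genCat (suc k) zero    = + 1   -- binom(k, 0) - 0
genCat (suc k) (suc n) =
  + ((2 * suc n + k) C suc n) - + ((2 * suc n + k) C n)

sumBelow : ℕ → (ℕ → ℤ) → ℤ
sumBelow zero    f = + 0
sumBelow (suc n) f = sumBelow n f +ℤ f n

-- Σ_{j=0}^{min(m, k-m-1)} C^{(k-2j)}_j, with the sum empty when k-m-1 < 0,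
-- i.e. when m ≥ k.  When m < k the number of terms is min(m, k-m-1) + 1.
lhs : ℕ → ℕ → ℤ
lhs m k =
  if m <ᵇ k
  then sumBelow (suc (m ⊓ (k ∸ m ∸ 1))) (λ j → genCat (k ∸ 2 * j) j)
  else + 0

-- For 2(j+1) ≤ k the term C^{(k+1-2(j+1))}_{j+1} is, by the closed formula, exactly
-- binom(k, j+1) - binom(k, j), while C^{(k+1)}_0 = 1 = binom(k, 0).  So the sum up to
-- M with 2M ≤ k telescopes to binom(k, M).  The upper limit M = min(m, k-m) satisfies
-- 2M ≤ k, and binom(k, min(m, k-m)) = binom(k, m) by symmetry; for m > k both sides
-- vanish.
module Submission where

open import Defs
open import Data.Nat using (ℕ; zero; suc; _+_; _*_; _∸_; _⊓_; _<ᵇ_; _≤_; _<_; s≤s; _≤?_)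
open import Data.Nat.Properties
open import Data.Nat.Combinatorics using (_C_; nCk≡nC[n∸k])
open import Data.Nat.Combinatorics.Specification using (k>n⇒nCk≡0)
open import Data.Integer using (ℤ; +_; -_; _-_) renaming (_+_ to _+ℤ_)
import Data.Integer.Properties as ℤ
open import Data.Bool using (true; false; T)
open import Data.Unit using (tt)
open import Relation.Nullary using (¬_; yes; no)
open import Relation.Binary.PropositionalEquality

i+[j-i]≡j : ∀ (i j : ℤ) → i +ℤ (j - i) ≡ j
i+[j-i]≡j i j = begin
  i +ℤ (j - i)      ≡⟨ cong (i +ℤ_) (ℤ.+-comm j (- i)) ⟩
  i +ℤ (- i +ℤ j)   ≡⟨ ℤ.+-assoc i (- i) j ⟨
  (i - i) +ℤ j      ≡⟨ cong (_+ℤ j) (ℤ.+-inverseʳ i) ⟩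
  + 0 +ℤ j          ≡⟨ ℤ.+-identityˡ j ⟩
  j                 ∎
  where open ≡-Reasoning

sumBelow-telescope : ∀ (f a : ℕ → ℤ) n → f 0 ≡ a 0 →
                     (∀ j → j < n → f (suc j) ≡ a (suc j) - a j) →
                     sumBelow (suc n) f ≡ a n
sumBelow-telescope f a zero    f0 step = trans (ℤ.+-identityˡ (f 0)) f0
sumBelow-telescope f a (suc n) f0 step = begin
  sumBelow (suc n) f +ℤ f (suc n)  ≡⟨ cong₂ _+ℤ_ ih (step n ≤-refl) ⟩
  a n +ℤ (a (suc n) - a n)         ≡⟨ i+[j-i]≡j (a n) (a (suc n)) ⟩
  a (suc n)                        ∎
  where
  open ≡-Reasoning
  ih : sumBelow (suc n) f ≡ a n
  ih = sumBelow-telescope f a n f0 (λ j j<n → step j (m≤n⇒m≤1+n j<n))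

genCat-ballot : ∀ k n → 2 * suc n ≤ k →
                genCat (suc k ∸ 2 * suc n) (suc n) ≡ + (k C suc n) - + (k C n)
genCat-ballot k n 2[n+1]≤k = begin
  genCat (suc k ∸ 2 * suc n) (suc n)               ≡⟨ cong (λ r → genCat r (suc n)) (+-∸-assoc 1 2[n+1]≤k) ⟩
  genCat (suc (k ∸ 2 * suc n)) (suc n)             ≡⟨⟩
  + (r C suc n) - + (r C n)                        ≡⟨ cong (λ x → + (x C suc n) - + (x C n)) (m+[n∸m]≡n 2[n+1]≤k) ⟩
  + (k C suc n) - + (k C n)                        ∎
  where
  open ≡-Reasoning
  r = 2 * suc n + (k ∸ 2 * suc n)

sumBelow-genCat≡binomial : ∀ k M → 2 * M ≤ k →
                           sumBelow (suc M) (λ j → genCat (suc k ∸ 2 * j) j) ≡ + (k C M)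
sumBelow-genCat≡binomial k M 2M≤k =
  sumBelow-telescope (λ j → genCat (suc k ∸ 2 * j) j) (λ j → + (k C j)) M refl
    (λ j j<M → genCat-ballot k j (≤-trans (*-monoʳ-≤ 2 j<M) 2M≤k))

2*[m⊓[k∸m]]≤k : ∀ {m k} → m ≤ k → 2 * (m ⊓ (k ∸ m)) ≤ k
2*[m⊓[k∸m]]≤k {m} {k} m≤k = begin
  2 * M                ≡⟨ cong (_+_ M) (+-identityʳ M) ⟩
  M + M                ≤⟨ +-mono-≤ (m⊓n≤m m (k ∸ m)) (m⊓n≤n m (k ∸ m)) ⟩
  m + (k ∸ m)          ≡⟨ m+[n∸m]≡n m≤k ⟩
  k                    ∎
  where
  open ≤-Reasoning
  M = m ⊓ (k ∸ m)

kC[m⊓[k∸m]]≡kCm : ∀ {m k} → m ≤ k → k C (m ⊓ (k ∸ m)) ≡ k C m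
kC[m⊓[k∸m]]≡kCm {m} {k} m≤k with m ≤? k ∸ m
... | yes m≤k∸m = cong (k C_) (m≤n⇒m⊓n≡m m≤k∸m)
... | no  m≰k∸m = trans (cong (k C_) (m≥n⇒m⊓n≡n (<⇒≤ (≰⇒> m≰k∸m)))) (sym (nCk≡nC[n∸k] m≤k))

lemma2 : (m k : ℕ) → lhs m (suc k) ≡ + (k C m)
lemma2 m k with m <ᵇ suc k in m<ᵇ1+k
... | false = cong +_ (sym (k>n⇒nCk≡0 (≰⇒> m≰k)))
  where
  m≰k : ¬ m ≤ k
  m≰k m≤k = subst T m<ᵇ1+k (<⇒<ᵇ (s≤s m≤k))
... | true with <ᵇ⇒< m (suc k) (subst T (sym m<ᵇ1+k) tt)
... | s≤s m≤k = begin
  sumBelow (suc (m ⊓ (suc k ∸ m ∸ 1))) F  ≡⟨ cong (λ t → sumBelow (suc (m ⊓ (t ∸ 1))) F) (+-∸-assoc 1 m≤k) ⟩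
  sumBelow (suc (m ⊓ (k ∸ m))) F          ≡⟨ sumBelow-genCat≡binomial k (m ⊓ (k ∸ m)) (2*[m⊓[k∸m]]≤k m≤k) ⟩
  + (k C (m ⊓ (k ∸ m)))                   ≡⟨ cong +_ (kC[m⊓[k∸m]]≡kCm m≤k) ⟩
  + (k C m)                               ∎
  where
  open ≡-Reasoning
  F : ℕ → ℤ
  F j = genCat (suc k ∸ 2 * j) j
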